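{- Let $p$ be a prime and let $a,b,c,d$ be invertible elements of $\mathbb Z_p$. Let $(u_n)_{n\ge1}$ be the Somos 4 sequence with initial values $(u_1,u_2,u_3,u_4)=(a,b,c,d)$. Then for every $i\ge0$, at most one of the four consecutive terms $u_{i+1},u_{i+2},u_{i+3},u_{i+4}$ is not invertible in $\mathbb Z_p$. In particular $$\mathrm{val}_p(u_{i+1})+\mathrm{val}_p(u_{i+2})+\mathrm{val}_p(u_{i+3})+\mathrm{val}_p(u_{i+4})=\max\big(\mathrm{val}_p(u_{i+1}),\mathrm{val}_p(u_{i+2}),\mathrm{val}_p(u_{i+3}),\mathrm{val}_p(u_{i+4})\big).$$
   Context: The generic Somos 4 sequence $(U_n)_{n\ge1}$ is defined over $\mathbb Q(A,B,C,D)$ by $U_1=A,U_2=B,U_3=C,U_4=D$ and $U_{n+4}=\frac{U_{n+1}U_{n+3}+U_{n+2}^2}{U_n}$ for $n\ge1$; each $U_n$ is a Laurent polynomial in $A,B,C,D$ with integer coefficients (Fomin–Zelevinsky's Laurent phenomenon). For invertible $a,b,c,d\in\mathbb Z_p$, the Somos 4 sequence with initial values $(a,b,c,d)$ is $u_n=U_n(a,b,c,d)\in\mathbb Z_p$; it satisfies $u_nu_{n+4}=u_{n+1}u_{n+3}+u_{n+2}^2$ for all $n\ge1$. $\mathrm{val}_p$ is the $p$-adic valuation (with $\mathrm{val}_p(0)=+\infty$). -}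

module Defs where

open import Level using (0ℓ)
open import Algebra.Bundles using (CommutativeRing; RawRing)
open import Data.Fin using (Fin; zero; suc)
open import Data.Nat as ℕ using (ℕ; suc)
open import Data.Integer as ℤ using (ℤ; +_; _-_; -_)
open import Data.Integer.Divisibility.Signed using (_∣_; ∣m∣n⇒∣m+n; ∣m⇒∣-m; ∣n⇒∣m*n; ∣m⇒∣m*n)
open import Data.Integer.Tactic.RingSolver using (solve-∀)
open import Data.Product using (_×_; Σ; _,_)
open import Relation.Binary.PropositionalEquality using (_≡_; subst; sym)
open import Relation.Nullary using (¬_)

-- Laurent polynomials in the four variables A,B,C,D (indexed by Fin 4)
-- with integer coefficients, as formal expressions: generated by
-- 0, 1, the variables, their inverses, +, * and negation.

data LExpr : Set where
  var  : Fin 4 → LExpr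
  ivar : Fin 4 → LExpr
  𝟘 𝟙  : LExpr
  _⊕_  : LExpr → LExpr → LExpr
  _⊗_  : LExpr → LExpr → LExpr
  ⊝_   : LExpr → LExpr

eval : (R : RawRing 0ℓ 0ℓ) → (Fin 4 → RawRing.Carrier R) → (Fin 4 → RawRing.Carrier R) →
       LExpr → RawRing.Carrier R
eval R x y (var i)  = x i
eval R x y (ivar i) = y i
eval R x y 𝟘        = RawRing.0# R
eval R x y 𝟙        = RawRing.1# R
eval R x y (e ⊕ f)  = RawRing._+_ R (eval R x y e) (eval R x y f)
eval R x y (e ⊗ f)  = RawRing._*_ R (eval R x y e) (eval R x y f)
eval R x y (⊝ e)    = RawRing.-_ R (eval R x y e)

-- U (indexed from 1; U 0 is irrelevant) is the generic Somos 4 sequence: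
-- U₁..U₄ are A,B,C,D and the Somos recurrence holds as an identity of
-- Laurent polynomials, i.e. after evaluation in every commutative ring at
-- every invertible tuple (x₀..x₃) (with inverses y₀..y₃).
IsGenericSomos4 : (ℕ → LExpr) → Set₁
IsGenericSomos4 U =
  (R : CommutativeRing 0ℓ 0ℓ) (x y : Fin 4 → CommutativeRing.Carrier R) →
  (∀ i → CommutativeRing._≈_ R (CommutativeRing._*_ R (x i) (y i)) (CommutativeRing.1# R)) →
  let open CommutativeRing R using (_≈_; _*_; _+_; rawRing)
      ev = eval rawRing x y
  in  ev (U 1) ≈ x zero × ev (U 2) ≈ x (suc zero)
    × ev (U 3) ≈ x (suc (suc zero)) × ev (U 4) ≈ x (suc (suc (suc zero)))
    × (∀ n → ev (U (suc n)) * ev (U (4 ℕ.+ suc n))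
              ≈ ev (U (1 ℕ.+ suc n)) * ev (U (3 ℕ.+ suc n))
                + ev (U (2 ℕ.+ suc n)) * ev (U (2 ℕ.+ suc n)))

-- The p-adic integers ℤ_p as the inverse limit of ℤ/p^k:
-- coherent sequences (s k)_k of integers with s (k+1) ≡ s k (mod p^k),
-- equality being congruence mod p^k for every k.

pk : ℕ → ℕ → ℤ
pk p k = + (p ℕ.^ k)

record ℤₚ (p : ℕ) : Set where
  constructor mkℤₚ
  field
    seq : ℕ → ℤ
    coh : ∀ k → pk p k ∣ (seq (suc k) - seq k)
open ℤₚ public

data ℕ∞ : Set where
  fin : ℕ → ℕ∞
  ∞   : ℕ∞

infixl 6 _+∞_
_+∞_ : ℕ∞ → ℕ∞ → ℕ∞
fin m +∞ fin n = fin (m ℕ.+ n)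
_     +∞ _     = ∞

max∞ : ℕ∞ → ℕ∞ → ℕ∞
max∞ (fin m) (fin n) = fin (m ℕ.⊔ n)
max∞ _       _       = ∞

module _ {p : ℕ} where

  _≈ₚ_ : ℤₚ p → ℤₚ p → Set
  a ≈ₚ b = ∀ k → pk p k ∣ (seq a k - seq b k)

  private
    cst : ℤ → ℤₚ p
    cst z = mkℤₚ (λ _ → z) (λ k → subst (pk p k ∣_) (sym (lem z)) ∣0)
      where
      open import Data.Integer.Divisibility.Signed using (∣-refl; divides)
      ∣0 : ∀ {i} → i ∣ ℤ.0ℤ
      ∣0 {i} = divides ℤ.0ℤ (sym (Data.Integer.Properties.*-zeroˡ i))
        where import Data.Integer.Properties
      lem : ∀ z → z - z ≡ ℤ.0ℤ
      lem = solve-∀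

  0ₚ 1ₚ : ℤₚ p
  0ₚ = cst ℤ.0ℤ
  1ₚ = cst ℤ.1ℤ

  _+ₚ_ : ℤₚ p → ℤₚ p → ℤₚ p
  a +ₚ b = mkℤₚ (λ k → seq a k ℤ.+ seq b k)
    (λ k → subst (pk p k ∣_) (sym (lem (seq a (suc k)) (seq a k) (seq b (suc k)) (seq b k)))
                 (∣m∣n⇒∣m+n (coh a k) (coh b k)))
    where
    lem : ∀ a₁ a₀ b₁ b₀ → (a₁ ℤ.+ b₁) - (a₀ ℤ.+ b₀) ≡ (a₁ - a₀) ℤ.+ (b₁ - b₀)
    lem = solve-∀

  _*ₚ_ : ℤₚ p → ℤₚ p → ℤₚ p
  a *ₚ b = mkℤₚ (λ k → seq a k ℤ.* seq b k)
    (λ k → subst (pk p k ∣_) (sym (lem (seq a (suc k)) (seq a k) (seq b (suc k)) (seq b k)))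
                 (∣m∣n⇒∣m+n (∣n⇒∣m*n (seq a (suc k)) (coh b k)) (∣m⇒∣m*n (seq b k) (coh a k))))
    where
    lem : ∀ a₁ a₀ b₁ b₀ → (a₁ ℤ.* b₁) - (a₀ ℤ.* b₀) ≡ a₁ ℤ.* (b₁ - b₀) ℤ.+ (a₁ - a₀) ℤ.* b₀
    lem = solve-∀

  -ₚ_ : ℤₚ p → ℤₚ p
  -ₚ a = mkℤₚ (λ k → - seq a k)
    (λ k → subst (pk p k ∣_) (sym (lem (seq a (suc k)) (seq a k))) (∣m⇒∣-m (coh a k)))
    where
    lem : ∀ a₁ a₀ → (- a₁) - (- a₀) ≡ - (a₁ - a₀)
    lem = solve-∀

  ℤₚ-rawRing : RawRing 0ℓ 0ℓ
  ℤₚ-rawRing = record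
    { Carrier = ℤₚ p ; _≈_ = _≈ₚ_ ; _+_ = _+ₚ_ ; _*_ = _*ₚ_ ; -_ = -ₚ_
    ; 0# = 0ₚ ; 1# = 1ₚ }

  Invertible : ℤₚ p → Set
  Invertible a = Σ (ℤₚ p) (λ b → (a *ₚ b) ≈ₚ 1ₚ)

  HasVal : ℤₚ p → ℕ∞ → Set
  HasVal a (fin k) = pk p k ∣ seq a k × ¬ (pk p (suc k) ∣ seq a (suc k))
  HasVal a ∞       = ∀ k → pk p k ∣ seq a k


  somosₚ : (U : ℕ → LExpr) (a b c d : ℤₚ p) →
           Invertible a → Invertible b → Invertible c → Invertible d → ℕ → ℤₚ p
  somosₚ U a b c d (a' , _) (b' , _) (c' , _) (d' , _) n =
    eval ℤₚ-rawRing (λ { zero → a ; (suc zero) → b ; (suc (suc zero)) → c ; (suc (suc (suc zero))) → d })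
                    (λ { zero → a' ; (suc zero) → b' ; (suc (suc zero)) → c' ; (suc (suc (suc zero))) → d' })
                    (U n)

module Submission where

-- Everything is read modulo p. The residues vₙ of the uₙ are the values in ℤ/p of the Laurent
-- polynomials Uₙ at the residues of a, b, c, d, so they satisfy the Somos 4 recurrence mod p,
-- and uₙ is a unit of ℤ_p exactly when p ∤ vₙ. By induction on n, p divides at most one of
-- vₙ, …, vₙ₊₃: none of v₁, …, v₄, and if p ∣ vₙ₊₄ then p ∣ vₙ₊₁vₙ₊₃ + vₙ₊₂², which by
-- primality makes p divide two terms of the previous window. Units have valuation 0, and a sum
-- of four valuations at most one of which is nonzero is their maximum.

open import Data.Nat using (ℕ)

module ModularIntegers where

  open import Level using (0ℓ)
  open import Algebra.Bundles using (CommutativeRing)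
  open import Algebra.Structures using (IsCommutativeRing)
  open import Data.Integer using (ℤ; _+_; _-_; -_; _*_; 0ℤ; 1ℤ)
  open import Data.Integer.Properties
  open import Data.Integer.Divisibility.Signed
  open import Data.Integer.Tactic.RingSolver using (solve-∀)
  open import Data.Product using (_,_)
  open import Relation.Binary.PropositionalEquality using (_≡_; refl; subst; sym)

  infix 4 _≡_[mod_]
  _≡_[mod_] : ℤ → ℤ → ℤ → Set
  a ≡ b [mod m ] = m ∣ a - b

  module _ {m : ℤ} where

    ≡⇒≡-mod : ∀ {a b} → a ≡ b → a ≡ b [mod m ]
    ≡⇒≡-mod {a} refl = subst (m ∣_) (sym (+-inverseʳ a)) (divides 0ℤ refl)

    ≡-mod-sym : ∀ {a b} → a ≡ b [mod m ] → b ≡ a [mod m ]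
    ≡-mod-sym {a} {b} h = subst (m ∣_) (lemma a b) (∣m⇒∣-m h)
      where lemma : ∀ a b → - (a - b) ≡ b - a
            lemma = solve-∀

    ≡-mod-trans : ∀ {a b c} → a ≡ b [mod m ] → b ≡ c [mod m ] → a ≡ c [mod m ]
    ≡-mod-trans {a} {b} {c} h k = subst (m ∣_) (lemma a b c) (∣m∣n⇒∣m+n h k)
      where lemma : ∀ a b c → (a - b) + (b - c) ≡ a - c
            lemma = solve-∀

    +-cong-mod : ∀ {a a′ b b′} → a ≡ a′ [mod m ] → b ≡ b′ [mod m ] → a + b ≡ a′ + b′ [mod m ]
    +-cong-mod {a} {a′} {b} {b′} h k = subst (m ∣_) (lemma a a′ b b′) (∣m∣n⇒∣m+n h k)
      where lemma : ∀ a a′ b b′ → (a - a′) + (b - b′) ≡ (a + b) - (a′ + b′)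
            lemma = solve-∀

    *-cong-mod : ∀ {a a′ b b′} → a ≡ a′ [mod m ] → b ≡ b′ [mod m ] → a * b ≡ a′ * b′ [mod m ]
    *-cong-mod {a} {a′} {b} {b′} h k =
      subst (m ∣_) (lemma a a′ b b′) (∣m∣n⇒∣m+n (∣n⇒∣m*n a k) (∣m⇒∣m*n b′ h))
      where lemma : ∀ a a′ b b′ → a * (b - b′) + (a - a′) * b′ ≡ a * b - a′ * b′
            lemma = solve-∀

    -‿cong-mod : ∀ {a a′} → a ≡ a′ [mod m ] → - a ≡ - a′ [mod m ]
    -‿cong-mod {a} {a′} h = subst (m ∣_) (lemma a a′) (∣m⇒∣-m h)
      where lemma : ∀ a a′ → - (a - a′) ≡ (- a) - (- a′)
            lemma = solve-∀

    ∣-resp-≡-mod : ∀ {a b} → a ≡ b [mod m ] → m ∣ a → m ∣ b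
    ∣-resp-≡-mod {a} {b} h m∣a = subst (m ∣_) (lemma a b) (∣m∣n⇒∣m-n m∣a h)
      where lemma : ∀ a b → a - (a - b) ≡ b
            lemma = solve-∀

  ℤ/_ : ℤ → CommutativeRing 0ℓ 0ℓ
  ℤ/ m = record
    { Carrier = ℤ ; _≈_ = _≡_[mod m ] ; _+_ = _+_ ; _*_ = _*_ ; -_ = -_ ; 0# = 0ℤ ; 1# = 1ℤ
    ; isCommutativeRing = isCommutativeRing }
    where
    isCommutativeRing : IsCommutativeRing _≡_[mod m ] _+_ _*_ -_ 0ℤ 1ℤ
    isCommutativeRing = record
      { isRing = record
        { +-isAbelianGroup = record
          { isGroup = record
            { isMonoid = record
              { isSemigroup = record
                { isMagma = record
                  { isEquivalence = record
                    { refl  = λ {x} → ≡⇒≡-mod {a = x} refl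
                    ; sym   = λ {x y} → ≡-mod-sym {a = x} {y}
                    ; trans = λ {x y z} → ≡-mod-trans {a = x} {y} {z} }
                  ; ∙-cong = λ {x y u v} → +-cong-mod {a = x} {y} {u} {v} }
                ; assoc = λ x y z → ≡⇒≡-mod (+-assoc x y z) }
              ; identity = (λ x → ≡⇒≡-mod (+-identityˡ x)) , (λ x → ≡⇒≡-mod (+-identityʳ x)) }
            ; inverse = (λ x → ≡⇒≡-mod (+-inverseˡ x)) , (λ x → ≡⇒≡-mod (+-inverseʳ x))
            ; ⁻¹-cong = λ {x y} → -‿cong-mod {a = x} {y} }
          ; comm = λ x y → ≡⇒≡-mod (+-comm x y) }
        ; *-cong = λ {x y u v} → *-cong-mod {a = x} {y} {u} {v}
        ; *-assoc = λ x y z → ≡⇒≡-mod (*-assoc x y z)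
        ; *-identity = (λ x → ≡⇒≡-mod (*-identityˡ x)) , (λ x → ≡⇒≡-mod (*-identityʳ x))
        ; distrib = (λ x y z → ≡⇒≡-mod (*-distribˡ-+ x y z)) , (λ x y z → ≡⇒≡-mod (*-distribʳ-+ x y z)) }
      ; *-comm = λ x y → ≡⇒≡-mod (*-comm x y) }

  inverse-unique-mod : ∀ {m x₀ y₀ x₁ y₁} → x₀ * y₀ ≡ 1ℤ [mod m ] → x₁ * y₁ ≡ 1ℤ [mod m ] →
                       x₁ ≡ x₀ [mod m ] → y₁ ≡ y₀ [mod m ]
  inverse-unique-mod {m} {x₀} {y₀} {x₁} {y₁} inv₀ inv₁ x₁≡x₀ =
    subst (m ∣_) (lemma x₀ y₀ x₁ y₁)
      (∣m∣n⇒∣m-n (∣m∣n⇒∣m-n (∣n⇒∣m*n y₀ inv₁) (∣n⇒∣m*n y₁ inv₀)) (∣n⇒∣m*n (y₀ * y₁) x₁≡x₀))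
    where
    lemma : ∀ x₀ y₀ x₁ y₁ → y₀ * (x₁ * y₁ - 1ℤ) - y₁ * (x₀ * y₀ - 1ℤ) - y₀ * y₁ * (x₁ - x₀) ≡ y₁ - y₀
    lemma = solve-∀

module IntegerPrimes where

  open import Data.Nat as ℕ using (ℕ; suc)
  import Data.Nat.Divisibility as ℕ
  open import Data.Nat.Primality using (Prime; euclidsLemma; prime⇒nonTrivial; prime⇒irreducible)
  open import Data.Nat.GCD using (module Bézout)
  open import Data.Nat.Coprimality using (Coprime; coprime-Bézout)
  open import Data.Integer as ℤ using (ℤ; +_; -[1+_]; _+_; _-_; -_; _*_; 1ℤ)
  open import Data.Integer.Properties using (abs-*; pos-+; pos-*; *-comm)
  open import Data.Integer.Divisibility.Signed
  open import Data.Integer.Tactic.RingSolver using (solve-∀)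
  open import Data.Empty using (⊥-elim)
  open import Data.Product using (Σ; _,_)
  open import Data.Sum using (_⊎_; inj₁; inj₂; [_,_]′)
  open import Function using (_∘_)
  open import Relation.Binary.PropositionalEquality using (_≡_; refl; subst; sym; trans; cong; module ≡-Reasoning)
  open import Relation.Nullary using (¬_)
  open ModularIntegers

  module _ {p : ℕ} (p-prime : Prime p) where

    prime-∤-1 : ¬ + p ∣ 1ℤ
    prime-∤-1 p∣1 with ℕ.∣1⇒≡1 (∣⇒∣ᵤ p∣1)
    ... | refl with prime⇒nonTrivial p-prime
    ... | ()

    euclidsLemmaℤ : ∀ a b → + p ∣ a * b → + p ∣ a ⊎ + p ∣ b
    euclidsLemmaℤ a b p∣ab =
      [ inj₁ ∘ ∣ᵤ⇒∣ , inj₂ ∘ ∣ᵤ⇒∣ ]′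
        (euclidsLemma ℤ.∣ a ∣ ℤ.∣ b ∣ p-prime (subst (p ℕ.∣_) (abs-* a b) (∣⇒∣ᵤ p∣ab)))

    private
      cast : ∀ a b c d → 1 ℕ.+ a ℕ.* b ≡ c ℕ.* d → 1ℤ + + a * + b ≡ + c * + d
      cast a b c d eq =
        trans (cong (λ z → 1ℤ + z) (sym (pos-* a b)))
              (trans (sym (pos-+ 1 (a ℕ.* b))) (trans (cong +_ eq) (pos-* c d)))

      inverse-mod-primeℕ : ∀ n → ¬ p ℕ.∣ n → Σ ℤ λ t → + n * t ≡ 1ℤ [mod + p ]
      inverse-mod-primeℕ n p∤n with coprime-Bézout coprime
        where
        coprime : Coprime p n
        coprime (d∣p , d∣n) with prime⇒irreducible p-prime d∣p
        ... | inj₁ d≡1 = d≡1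
        ... | inj₂ refl = ⊥-elim (p∤n d∣n)
      ... | Bézout.+- x y eq =
        - + y , subst (+ p ∣_) (lemma (+ n) (+ y)) (∣m⇒∣-m (divides (+ x) (cast y n x p eq)))
        where
        lemma : ∀ n y → - (1ℤ + y * n) ≡ n * - y - 1ℤ
        lemma = solve-∀
      ... | Bézout.-+ x y eq = + y , subst (+ p ∣_) (sym nyx) (divides (+ x) refl)
        where
        open ≡-Reasoning
        nyx : + n * + y - 1ℤ ≡ + x * + p
        nyx = begin
          + n * + y - 1ℤ        ≡⟨ cong (_- 1ℤ) (*-comm (+ n) (+ y)) ⟩
          + y * + n - 1ℤ        ≡⟨ cong (_- 1ℤ) (sym (cast x p y n eq)) ⟩
          1ℤ + + x * + p - 1ℤ   ≡⟨ lemma (+ x * + p) ⟩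
          + x * + p             ∎
          where lemma : ∀ z → 1ℤ + z - 1ℤ ≡ z
                lemma = solve-∀

    inverse-mod-prime : ∀ z → ¬ + p ∣ z → Σ ℤ λ t → z * t ≡ 1ℤ [mod + p ]
    inverse-mod-prime (+ n) p∤n = inverse-mod-primeℕ n (p∤n ∘ ∣ᵤ⇒∣)
    inverse-mod-prime -[1+ m ] p∤z with inverse-mod-primeℕ (suc m) (p∤z ∘ ∣m⇒∣-m ∘ ∣ᵤ⇒∣)
    ... | t , mt≡1 = - t , subst (λ w → + p ∣ w - 1ℤ) (lemma (+ suc m) t) mt≡1
      where lemma : ∀ a t → a * t ≡ (- a) * (- t)
            lemma = solve-∀

module PAdic {p : ℕ} where

  open import Defs
  open import Algebra.Bundles using (CommutativeRing)
  open import Data.Nat as ℕ using (ℕ; zero; suc)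
  open import Data.Nat.Primality using (Prime)
  open import Data.Fin using (Fin)
  open import Data.Integer using (ℤ; +_; _+_; _-_; -_; _*_; _^_; 0ℤ; 1ℤ)
  open import Function using (_∘_)
  open import Data.Integer.Properties using (pos-*; *-zeroʳ; *-identityʳ)
  open import Data.Integer.Divisibility.Signed
  open import Data.Integer.Tactic.RingSolver using (solve-∀)
  open import Data.Empty using (⊥-elim)
  open import Data.Product using (_,_)
  open import Relation.Binary.PropositionalEquality using (_≡_; refl; subst; sym; cong; cong₂; module ≡-Reasoning)
  open import Relation.Nullary using (¬_)
  open import Relation.Nullary.Decidable using (decidable-stable)
  open ModularIntegers
  open IntegerPrimes

  residue : ℤₚ p → ℤ
  residue x = seq x 1

  pk-suc : ∀ k → pk p (suc k) ≡ + p * pk p k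
  pk-suc k = pos-* p (p ℕ.^ k)

  pk∣pk-suc : ∀ k → pk p k ∣ pk p (suc k)
  pk∣pk-suc k = subst (pk p k ∣_) (sym (pk-suc k)) (∣n⇒∣m*n (+ p) ∣-refl)

  pk-suc-∣⇒p∣ : ∀ k {z} → pk p (suc k) ∣ z → + p ∣ z
  pk-suc-∣⇒p∣ k = ∣-trans (subst (+ p ∣_) (sym (pk-suc k)) (∣m⇒∣m*n (pk p k) ∣-refl))

  p∣⇒pk∣^ : ∀ {e} n → + p ∣ e → pk p n ∣ e ^ n
  p∣⇒pk∣^ zero    p∣e = ∣-refl
  p∣⇒pk∣^ {e} (suc n) p∣e =
    subst (_∣ e ^ suc n) (sym (pk-suc n))
          (∣-trans (*-monoʳ-∣ (+ p) (p∣⇒pk∣^ n p∣e)) (*-monoˡ-∣ (e ^ n) p∣e))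

  seq≡residue : ∀ x k → seq x (suc k) ≡ residue x [mod + p ]
  seq≡residue x zero    = ≡⇒≡-mod {a = residue x} refl
  seq≡residue x (suc k) =
    ≡-mod-trans {a = seq x (suc (suc k))} (pk-suc-∣⇒p∣ k (coh x (suc k))) (seq≡residue x k)

  p∣seq⇒p∣residue : ∀ x k → + p ∣ seq x (suc k) → + p ∣ residue x
  p∣seq⇒p∣residue x k = ∣-resp-≡-mod (seq≡residue x k)

  -- The modulus m is irrelevant: eval only uses the operations of ℤ/ m, which are those of ℤ.
  seq-eval : ∀ {m k} {X Y : Fin 4 → ℤₚ p} {x y : Fin 4 → ℤ} →
             (∀ i → seq (X i) k ≡ x i) → (∀ i → seq (Y i) k ≡ y i) →
             ∀ e → seq (eval ℤₚ-rawRing X Y e) k ≡ eval (CommutativeRing.rawRing (ℤ/ m)) x y e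
  seq-eval X≡x Y≡y (var i)  = X≡x i
  seq-eval X≡x Y≡y (ivar i) = Y≡y i
  seq-eval X≡x Y≡y 𝟘        = refl
  seq-eval X≡x Y≡y 𝟙        = refl
  seq-eval X≡x Y≡y (e ⊕ f)  = cong₂ _+_ (seq-eval X≡x Y≡y e) (seq-eval X≡x Y≡y f)
  seq-eval X≡x Y≡y (e ⊗ f)  = cong₂ _*_ (seq-eval X≡x Y≡y e) (seq-eval X≡x Y≡y f)
  seq-eval X≡x Y≡y (⊝ e)    = cong -_ (seq-eval X≡x Y≡y e)

  residue-inverse : ∀ {x} → ((y , xy≈1) : Invertible x) → residue x * residue y ≡ 1ℤ [mod + p ]
  residue-inverse (y , xy≈1) = pk-suc-∣⇒p∣ 0 (xy≈1 1)

  hasVal-unit : ∀ {x w} → ¬ + p ∣ residue x → HasVal x w → w ≡ fin 0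
  hasVal-unit {w = ∞}           p∤x pk∣x       = ⊥-elim (p∤x (pk-suc-∣⇒p∣ 0 (pk∣x 1)))
  hasVal-unit {w = fin zero}    p∤x _          = refl
  hasVal-unit {x} {fin (suc k)} p∤x (pk∣x , _) = ⊥-elim (p∤x (p∣seq⇒p∣residue x k (pk-suc-∣⇒p∣ k pk∣x)))

  geometric-sum : ℕ → ℤ → ℤ
  geometric-sum zero    e = 0ℤ
  geometric-sum (suc n) e = 1ℤ + e * geometric-sum n e

  geometric-sum-telescopes : ∀ n e → (1ℤ - e) * geometric-sum n e ≡ 1ℤ - e ^ n
  geometric-sum-telescopes zero    e = *-zeroʳ (1ℤ - e)
  geometric-sum-telescopes (suc n) e = begin
    (1ℤ - e) * (1ℤ + e * geometric-sum n e)
      ≡⟨ expand e (geometric-sum n e) ⟩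
    (1ℤ - e) + e * ((1ℤ - e) * geometric-sum n e)
      ≡⟨ cong (λ z → (1ℤ - e) + e * z) (geometric-sum-telescopes n e) ⟩
    (1ℤ - e) + e * (1ℤ - e ^ n)
      ≡⟨ collapse e (e ^ n) ⟩
    1ℤ - e * e ^ n
      ∎
    where
    open ≡-Reasoning
    expand : ∀ e g → (1ℤ - e) * (1ℤ + e * g) ≡ (1ℤ - e) + e * ((1ℤ - e) * g)
    expand = solve-∀
    collapse : ∀ e f → (1ℤ - e) + e * (1ℤ - f) ≡ 1ℤ - e * f
    collapse = solve-∀

  module _ (p-prime : Prime p) where

    invertible⇒p∤residue : ∀ {x} → Invertible x → ¬ + p ∣ residue x
    invertible⇒p∤residue {x} inv@(y , _) p∣x =
      prime-∤-1 p-prime (∣-resp-≡-mod (residue-inverse {x} inv) (∣m⇒∣m*n (residue y) p∣x))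

    p∤residue⇒invertible : ∀ {x} → ¬ + p ∣ residue x → Invertible x
    -- With x₁ t ≡ 1 mod p and e = 1 - xₖ t, the approximation yₖ = t (1 + e + ⋯ + eᵏ⁻¹)
    -- satisfies xₖ yₖ = 1 - eᵏ ≡ 1 mod pᵏ.
    p∤residue⇒invertible {x} p∤x with inverse-mod-prime p-prime (residue x) p∤x
    ... | t , xt≡1 = mkℤₚ y y-coh , inverse
      where
      e : ℕ → ℤ
      e k = 1ℤ - seq x k * t

      y : ℕ → ℤ
      y k = t * geometric-sum k (e k)

      p∣e : ∀ k → + p ∣ e (suc k)
      p∣e k = subst (+ p ∣_) (lemma (seq x (suc k)) (residue x) t)
                (∣m⇒∣-m (∣m∣n⇒∣m+n (∣m⇒∣m*n t (seq≡residue x k)) xt≡1))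
        where lemma : ∀ xₖ x₁ t → - ((xₖ - x₁) * t + (x₁ * t - 1ℤ)) ≡ 1ℤ - xₖ * t
              lemma = solve-∀

      xy-1 : ∀ k → seq x k * y k - 1ℤ ≡ - (e k ^ k)
      xy-1 k = begin
        seq x k * (t * geometric-sum k (e k)) - 1ℤ ≡⟨ regroup (seq x k) t (geometric-sum k (e k)) ⟩
        (1ℤ - e k) * geometric-sum k (e k) - 1ℤ    ≡⟨ cong (_- 1ℤ) (geometric-sum-telescopes k (e k)) ⟩
        (1ℤ - e k ^ k) - 1ℤ                        ≡⟨ cancel (e k ^ k) ⟩
        - (e k ^ k)                                ∎
        where
        open ≡-Reasoning
        regroup : ∀ x t g → x * (t * g) - 1ℤ ≡ (1ℤ - (1ℤ - x * t)) * g - 1ℤ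
        regroup = solve-∀
        cancel : ∀ f → (1ℤ - f) - 1ℤ ≡ - f
        cancel = solve-∀

      inverse : ∀ k → seq x k * y k ≡ 1ℤ [mod pk p k ]
      inverse zero    = divides (seq x 0 * y 0 - 1ℤ) (sym (*-identityʳ _))
      inverse (suc k) = subst (pk p (suc k) ∣_) (sym (xy-1 (suc k))) (∣m⇒∣-m (p∣⇒pk∣^ (suc k) (p∣e k)))

      y-coh : ∀ k → pk p k ∣ y (suc k) - y k
      y-coh k = inverse-unique-mod {x₀ = seq x k} {y k} {seq x (suc k)} {y (suc k)}
                  (inverse k) (∣-trans (pk∣pk-suc k) (inverse (suc k))) (coh x k)

    ¬invertible⇒p∣residue : ∀ {x} → ¬ Invertible x → + p ∣ residue x
    ¬invertible⇒p∣residue {x} ¬inv =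
      decidable-stable (+ p ∣? residue x) (¬inv ∘ p∤residue⇒invertible {x})

module SomosWindows where

  open import Data.Nat as ℕ using (ℕ; zero; suc)
  open import Data.Fin using (Fin; zero; suc; toℕ)
  open import Data.Integer using (ℤ; _+_; _*_)
  open import Data.Integer.Divisibility.Signed
  open import Data.Empty using (⊥-elim)
  open import Data.Sum using (_⊎_; [_,_]′)
  open import Function using (id)
  open import Relation.Binary.PropositionalEquality using (_≡_; refl)
  open import Relation.Nullary using (¬_)
  open ModularIntegers

  AtMostOne : ∀ {n} → (Fin n → Set) → Set
  AtMostOne Q = ∀ j k → Q j → Q k → j ≡ k

  SomosMod : ℤ → (ℕ → ℤ) → Set
  SomosMod m v = ∀ n → v (suc n) * v (4 ℕ.+ suc n)
                       ≡ v (1 ℕ.+ suc n) * v (3 ℕ.+ suc n) + v (2 ℕ.+ suc n) * v (2 ℕ.+ suc n) [mod m ]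

  module _ {m : ℤ} (m-prime : ∀ a b → m ∣ a * b → m ∣ a ⊎ m ∣ b) (v : ℕ → ℤ) (somos : SomosMod m v) where

    record Window (n : ℕ) : Set where
      field
        apart₀₁ : m ∣ v n → ¬ m ∣ v (1 ℕ.+ n)
        apart₀₂ : m ∣ v n → ¬ m ∣ v (2 ℕ.+ n)
        apart₀₃ : m ∣ v n → ¬ m ∣ v (3 ℕ.+ n)
        apart₁₂ : m ∣ v (1 ℕ.+ n) → ¬ m ∣ v (2 ℕ.+ n)
        apart₁₃ : m ∣ v (1 ℕ.+ n) → ¬ m ∣ v (3 ℕ.+ n)
        apart₂₃ : m ∣ v (2 ℕ.+ n) → ¬ m ∣ v (3 ℕ.+ n)
    open Window

    m∣square⇒m∣ : ∀ {a} → m ∣ a * a → m ∣ a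
    m∣square⇒m∣ {a} m∣aa = [ id , id ]′ (m-prime a a m∣aa)

    window-start : (∀ (j : Fin 4) → ¬ m ∣ v (toℕ j ℕ.+ 1)) → Window 1
    window-start start = record
      { apart₀₁ = λ m∣v₁ _ → start zero m∣v₁
      ; apart₀₂ = λ m∣v₁ _ → start zero m∣v₁
      ; apart₀₃ = λ m∣v₁ _ → start zero m∣v₁
      ; apart₁₂ = λ m∣v₂ _ → start (suc zero) m∣v₂
      ; apart₁₃ = λ m∣v₂ _ → start (suc zero) m∣v₂
      ; apart₂₃ = λ m∣v₃ _ → start (suc (suc zero)) m∣v₃
      }

    window-step : ∀ {n} → Window (suc n) → Window (suc (suc n))
    window-step {n} w = record
      { apart₀₁ = apart₁₂ w
      ; apart₀₂ = apart₁₃ w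
      ; apart₁₂ = apart₂₃ w
      ; apart₀₃ = λ m∣t₁ m∣t₄ →
          apart₁₂ w m∣t₁ (m∣square⇒m∣ (∣m+n∣m⇒∣n (m∣rhs m∣t₄) (∣m⇒∣m*n t₃ m∣t₁)))
      ; apart₁₃ = λ m∣t₂ m∣t₄ →
          [ (λ m∣t₁ → apart₁₂ w m∣t₁ m∣t₂) , apart₂₃ w m∣t₂ ]′
            (m-prime t₁ t₃ (∣m+n∣n⇒∣m (m∣rhs m∣t₄) (∣m⇒∣m*n t₂ m∣t₂)))
      ; apart₂₃ = λ m∣t₃ m∣t₄ →
          apart₂₃ w (m∣square⇒m∣ (∣m+n∣m⇒∣n (m∣rhs m∣t₄) (∣n⇒∣m*n t₁ m∣t₃))) m∣t₃
      }
      where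
      t₁ t₂ t₃ t₄ : ℤ
      t₁ = v (1 ℕ.+ suc n)
      t₂ = v (2 ℕ.+ suc n)
      t₃ = v (3 ℕ.+ suc n)
      t₄ = v (4 ℕ.+ suc n)
      m∣rhs : m ∣ t₄ → m ∣ t₁ * t₃ + t₂ * t₂
      m∣rhs m∣t₄ = ∣-resp-≡-mod (somos n) (∣n⇒∣m*n (v (suc n)) m∣t₄)

    window : (∀ (j : Fin 4) → ¬ m ∣ v (toℕ j ℕ.+ 1)) → ∀ n → Window (suc n)
    window start zero    = window-start start
    window start (suc n) = window-step (window start n)

    window⇒atMostOne : ∀ {n} → Window n → AtMostOne (λ (j : Fin 4) → m ∣ v (toℕ j ℕ.+ n))
    window⇒atMostOne w zero                   zero                   _ _ = refl
    window⇒atMostOne w (suc zero)             (suc zero)             _ _ = refl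
    window⇒atMostOne w (suc (suc zero))       (suc (suc zero))       _ _ = refl
    window⇒atMostOne w (suc (suc (suc zero))) (suc (suc (suc zero))) _ _ = refl
    window⇒atMostOne w zero                   (suc zero)             a b = ⊥-elim (apart₀₁ w a b)
    window⇒atMostOne w (suc zero)             zero                   a b = ⊥-elim (apart₀₁ w b a)
    window⇒atMostOne w zero                   (suc (suc zero))       a b = ⊥-elim (apart₀₂ w a b)
    window⇒atMostOne w (suc (suc zero))       zero                   a b = ⊥-elim (apart₀₂ w b a)
    window⇒atMostOne w zero                   (suc (suc (suc zero))) a b = ⊥-elim (apart₀₃ w a b)
    window⇒atMostOne w (suc (suc (suc zero))) zero                   a b = ⊥-elim (apart₀₃ w b a)
    window⇒atMostOne w (suc zero)             (suc (suc zero))       a b = ⊥-elim (apart₁₂ w a b)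
    window⇒atMostOne w (suc (suc zero))       (suc zero)             a b = ⊥-elim (apart₁₂ w b a)
    window⇒atMostOne w (suc zero)             (suc (suc (suc zero))) a b = ⊥-elim (apart₁₃ w a b)
    window⇒atMostOne w (suc (suc (suc zero))) (suc zero)             a b = ⊥-elim (apart₁₃ w b a)
    window⇒atMostOne w (suc (suc zero))       (suc (suc (suc zero))) a b = ⊥-elim (apart₂₃ w a b)
    window⇒atMostOne w (suc (suc (suc zero))) (suc (suc zero))       a b = ⊥-elim (apart₂₃ w b a)

open import Defs
open import Algebra.Bundles using (CommutativeRing)
open import Data.Nat using (suc; _+_)
open import Data.Nat.Properties using (+-identityʳ; ⊔-identityʳ; +-comm; +-suc)
open import Data.Nat.Primality using (Prime)
open import Data.Fin using (Fin; zero; suc; toℕ)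
open import Data.Vec using ([]; _∷_; lookup)
open import Data.Integer as ℤ using (ℤ; +_; 1ℤ)
open import Data.Integer.Divisibility.Signed using (_∣_; _∣?_)
open import Data.Product using (_×_; Σ; _,_; proj₁; proj₂)
open import Data.Sum using (_⊎_)
open import Function using (_∘_)
open import Relation.Binary.PropositionalEquality using (_≡_; refl; subst; trans; cong)
open import Relation.Nullary using (¬_; yes; no)
open ModularIntegers
open IntegerPrimes
open PAdic
open SomosWindows

sum≡max-others-zero₁ : ∀ x → x +∞ fin 0 +∞ fin 0 +∞ fin 0 ≡ max∞ (max∞ (max∞ x (fin 0)) (fin 0)) (fin 0)
sum≡max-others-zero₁ ∞       = refl
sum≡max-others-zero₁ (fin n) rewrite +-identityʳ n | +-identityʳ n | +-identityʳ n
                                   | ⊔-identityʳ n | ⊔-identityʳ n | ⊔-identityʳ n = refl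

sum≡max-others-zero₂ : ∀ x → fin 0 +∞ x +∞ fin 0 +∞ fin 0 ≡ max∞ (max∞ (max∞ (fin 0) x) (fin 0)) (fin 0)
sum≡max-others-zero₂ ∞       = refl
sum≡max-others-zero₂ (fin n) rewrite +-identityʳ n | +-identityʳ n | ⊔-identityʳ n | ⊔-identityʳ n = refl

sum≡max-others-zero₃ : ∀ x → fin 0 +∞ fin 0 +∞ x +∞ fin 0 ≡ max∞ (max∞ (max∞ (fin 0) (fin 0)) x) (fin 0)
sum≡max-others-zero₃ ∞       = refl
sum≡max-others-zero₃ (fin n) rewrite +-identityʳ n | ⊔-identityʳ n = refl

sum≡max-others-zero₄ : ∀ x → fin 0 +∞ fin 0 +∞ fin 0 +∞ x ≡ max∞ (max∞ (max∞ (fin 0) (fin 0)) (fin 0)) x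
sum≡max-others-zero₄ ∞       = refl
sum≡max-others-zero₄ (fin n) = refl

module _ {p : ℕ} {w : Fin 4 → ℤₚ p} (atMostOne : AtMostOne (λ j → + p ∣ residue (w j))) where

  private
    hasVal-zero : ∀ {j k v} → + p ∣ residue (w j) → ¬ j ≡ k → HasVal (w k) v → v ≡ fin 0
    hasVal-zero p∣wⱼ j≢k = hasVal-unit (λ p∣wₖ → j≢k (atMostOne _ _ p∣wⱼ p∣wₖ))

  atMostOne-nonUnit⇒val-sum≡max : ∀ {v₁ v₂ v₃ v₄} →
    HasVal (w zero) v₁ → HasVal (w (suc zero)) v₂ →
    HasVal (w (suc (suc zero))) v₃ → HasVal (w (suc (suc (suc zero)))) v₄ →
    v₁ +∞ v₂ +∞ v₃ +∞ v₄ ≡ max∞ (max∞ (max∞ v₁ v₂) v₃) v₄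
  atMostOne-nonUnit⇒val-sum≡max {v₁} {v₂} {v₃} {v₄} h₁ h₂ h₃ h₄
    with + p ∣? residue (w zero) | + p ∣? residue (w (suc zero)) | + p ∣? residue (w (suc (suc zero)))
  ... | yes p∣w₁ | _ | _
    rewrite hasVal-zero p∣w₁ (λ ()) h₂ | hasVal-zero p∣w₁ (λ ()) h₃ | hasVal-zero p∣w₁ (λ ()) h₄
    = sum≡max-others-zero₁ v₁
  ... | no p∤w₁ | yes p∣w₂ | _
    rewrite hasVal-unit p∤w₁ h₁ | hasVal-zero p∣w₂ (λ ()) h₃ | hasVal-zero p∣w₂ (λ ()) h₄
    = sum≡max-others-zero₂ v₂
  ... | no p∤w₁ | no p∤w₂ | yes p∣w₃
    rewrite hasVal-unit p∤w₁ h₁ | hasVal-unit p∤w₂ h₂ | hasVal-zero p∣w₃ (λ ()) h₄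
    = sum≡max-others-zero₃ v₃
  ... | no p∤w₁ | no p∤w₂ | no p∤w₃
    rewrite hasVal-unit p∤w₁ h₁ | hasVal-unit p∤w₂ h₂ | hasVal-unit p∤w₃ h₃
    = sum≡max-others-zero₄ v₄

somosₚ-atMostOne-nonUnit : (U : ℕ → LExpr) → IsGenericSomos4 U → ∀ {p} → Prime p →
  {a b c d : ℤₚ p} (ia : Invertible a) (ib : Invertible b) (ic : Invertible c) (id : Invertible d) →
  ∀ i → AtMostOne (λ j → + p ∣ residue (somosₚ U a b c d ia ib ic id (suc i + toℕ j)))
somosₚ-atMostOne-nonUnit U isSomos {p} p-prime {a} {b} {c} {d} ia ib ic id i j k p∣uⱼ p∣uₖ =
  window⇒atMostOne p-prime-ℤ v recurrence (window p-prime-ℤ v recurrence start i)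
    j k (reindex j p∣uⱼ) (reindex k p∣uₖ)
  where
  initial : Fin 4 → Σ (ℤₚ p) Invertible
  initial = lookup ((a , ia) ∷ (b , ib) ∷ (c , ic) ∷ (d , id) ∷ [])

  x y : Fin 4 → ℤ
  x j = residue (proj₁ (initial j))
  y j = residue (proj₁ (proj₂ (initial j)))

  xy≡1 : ∀ j → x j ℤ.* y j ≡ 1ℤ [mod + p ]
  xy≡1 j = residue-inverse {x = proj₁ (initial j)} (proj₂ (initial j))

  v : ℕ → ℤ
  v n = eval (CommutativeRing.rawRing (ℤ/ (+ p))) x y (U n)

  p-prime-ℤ : ∀ a b → + p ∣ a ℤ.* b → + p ∣ a ⊎ + p ∣ b
  p-prime-ℤ = euclidsLemmaℤ p-prime

  recurrence : SomosMod (+ p) v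
  recurrence = proj₂ (proj₂ (proj₂ (proj₂ (isSomos (ℤ/ (+ p)) x y xy≡1))))

  residue≡v : ∀ n → residue (somosₚ U a b c d ia ib ic id n) ≡ v n
  residue≡v n = seq-eval {m = + p}
    (λ { zero → refl ; (suc zero) → refl ; (suc (suc zero)) → refl ; (suc (suc (suc zero))) → refl })
    (λ { zero → refl ; (suc zero) → refl ; (suc (suc zero)) → refl ; (suc (suc (suc zero))) → refl })
    (U n)

  initial-values : ∀ j → v (toℕ j + 1) ≡ x j [mod + p ]
  initial-values with isSomos (ℤ/ (+ p)) x y xy≡1
  ... | U₁≈A , U₂≈B , U₃≈C , U₄≈D , _ =
    λ { zero → U₁≈A ; (suc zero) → U₂≈B ; (suc (suc zero)) → U₃≈C ; (suc (suc (suc zero))) → U₄≈D }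

  start : ∀ j → ¬ + p ∣ v (toℕ j + 1)
  start j =
    invertible⇒p∤residue p-prime {proj₁ (initial j)} (proj₂ (initial j)) ∘ ∣-resp-≡-mod (initial-values j)

  reindex : ∀ j → + p ∣ residue (somosₚ U a b c d ia ib ic id (suc i + toℕ j)) → + p ∣ v (toℕ j + suc i)
  reindex j = subst (+ p ∣_) (trans (residue≡v _) (cong v (+-comm (suc i) (toℕ j))))

lemma3p43 : (U : ℕ → LExpr) → IsGenericSomos4 U →
    (p : ℕ) → Prime p →
    (a b c d : ℤₚ p) (ia : Invertible a) (ib : Invertible b) (ic : Invertible c) (id : Invertible d) →
    (∀ (i : ℕ) (j k : Fin 4) →
       ¬ Invertible (somosₚ U a b c d ia ib ic id (suc i + toℕ j)) →
       ¬ Invertible (somosₚ U a b c d ia ib ic id (suc i + toℕ k)) →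
       j ≡ k)
    × (∀ (i : ℕ) (v₁ v₂ v₃ v₄ : ℕ∞) →
       HasVal (somosₚ U a b c d ia ib ic id (i + 1)) v₁ →
       HasVal (somosₚ U a b c d ia ib ic id (i + 2)) v₂ →
       HasVal (somosₚ U a b c d ia ib ic id (i + 3)) v₃ →
       HasVal (somosₚ U a b c d ia ib ic id (i + 4)) v₄ →
       v₁ +∞ v₂ +∞ v₃ +∞ v₄ ≡ max∞ (max∞ (max∞ v₁ v₂) v₃) v₄)
lemma3p43 U isSomos p p-prime a b c d ia ib ic id =
    (λ i j k ¬uⱼ ¬uₖ → nonUnits i j k (¬invertible⇒p∣residue p-prime {u (suc i + toℕ j)} ¬uⱼ)
                                    (¬invertible⇒p∣residue p-prime {u (suc i + toℕ k)} ¬uₖ))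
  , (λ i _ _ _ _ h₁ h₂ h₃ h₄ →
       atMostOne-nonUnit⇒val-sum≡max {w = λ j → u (suc i + toℕ j)} (nonUnits i)
         (shift i h₁) (shift i h₂) (shift i h₃) (shift i h₄))
  where
  u : ℕ → ℤₚ p
  u = somosₚ U a b c d ia ib ic id

  nonUnits : ∀ i → AtMostOne (λ j → + p ∣ residue (u (suc i + toℕ j)))
  nonUnits = somosₚ-atMostOne-nonUnit U isSomos p-prime ia ib ic id

  shift : ∀ i {k v} → HasVal (u (i + suc k)) v → HasVal (u (suc i + k)) v
  shift i {k} {v} = subst (λ n → HasVal (u n) v) (+-suc i k)
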